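{- Let $\tau=\tau_1\dots\tau_k$ be a nonempty triangular partition. The following are equivalent: (a) $\tau$ is wide; (b) $\tau_1\ge k$; (c) the parts of $\tau$ are distinct. Moreover, the following are equivalent: (a') $\tau$ is both wide and tall; (b') $\tau_1=k$; (c') $\tau$ is the staircase partition $(k,k-1,\dots,2,1)$.
   Context: $\mathbb{N}$ denotes the positive integers. A partition $\tau=\tau_1\dots\tau_k$ (positive weakly decreasing parts) is identified with its Ferrers diagram $\{(a,b)\in\mathbb{N}^2:1\le b\le k,\,1\le a\le\tau_b\}$. For $r,s>0$, $\mathsf{L}_{r,s}$ is the line $x/r+y/s=1$; it is a cutting line for $\tau$ if $\tau$ is exactly the set of points of $\mathbb{N}^2$ on or below it, and $\tau$ is triangular if it has a cutting line. A triangular partition is wide (resp. tall) if it has a cutting line $\mathsf{L}_{r,s}$ with $r>s$ (resp. $r<s$).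
   Formalization: The parameters r and s of the lines $\mathsf{L}_{r,s}$ are positive rationals rather than positive reals, so the notions of triangular, wide and tall partition refer to these lines. -}

module Defs where

open import Data.Nat as ℕ using (ℕ; zero; suc; _≤_)
open import Data.Integer using (+_)
open import Data.Rational as ℚ using (ℚ; Positive; 1/_; 1ℚ)
open import Data.Rational.Properties using (pos⇒nonZero)
open import Data.List using (List; []; _∷_; length)
open import Data.List.Relation.Unary.All using (All)
open import Data.List.Relation.Unary.Linked using (Linked)
open import Data.Product using (Σ; _×_; ∃)
open import Function.Bundles using (_⇔_)
open import Relation.Binary.PropositionalEquality using (_≡_)

ℕ→ℚ : ℕ → ℚ
ℕ→ℚ n = (+ n) ℚ./ 1

IsPartition : List ℕ → Set
IsPartition τ = All (λ x → 1 ≤ x) τ × Linked (λ x y → y ≤ x) τ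

-- part τ b = τ_b  (1-indexed; 0 when b = 0 or b > length τ)
part : List ℕ → ℕ → ℕ
part []      _             = 0
part (x ∷ τ) zero          = 0
part (x ∷ τ) (suc zero)    = x
part (x ∷ τ) (suc (suc b)) = part τ (suc b)

InDiagram : List ℕ → ℕ → ℕ → Set
InDiagram τ a b = (1 ≤ b) × (b ≤ length τ) × (1 ≤ a) × (a ≤ part τ b)

-- the line L_{r,s} : x/r + y/s = 1 with r, s > 0 (rational parameters)
record Line : Set where
  constructor L
  field
    r s  : ℚ
    r>0  : Positive r
    s>0  : Positive s

OnOrBelow : Line → ℕ → ℕ → Set
OnOrBelow (L r s r>0 s>0) a b =
  ℕ→ℚ a ℚ.* (1/ r) {{pos⇒nonZero r {{r>0}}}}
    ℚ.+ ℕ→ℚ b ℚ.* (1/ s) {{pos⇒nonZero s {{s>0}}}} ℚ.≤ 1ℚ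

CuttingLine : List ℕ → Line → Set
CuttingLine τ ℓ = ∀ a b → 1 ≤ a → 1 ≤ b → (InDiagram τ a b ⇔ OnOrBelow ℓ a b)

Triangular : List ℕ → Set
Triangular τ = ∃ λ ℓ → CuttingLine τ ℓ

Wide : List ℕ → Set
Wide τ = ∃ λ ℓ → CuttingLine τ ℓ × (Line.s ℓ ℚ.< Line.r ℓ)

Tall : List ℕ → Set
Tall τ = ∃ λ ℓ → CuttingLine τ ℓ × (Line.r ℓ ℚ.< Line.s ℓ)

staircase : ℕ → List ℕ
staircase zero    = []
staircase (suc k) = suc k ∷ staircase k

-- Clearing denominators turns a line L_{r,s} into an integer inequality a·A + b·B ≤ D
-- with s < r iff A < B.  For fixed a + b the weight a·A + b·B is monotone along the
-- antidiagonal: if A ≤ B, trading a unit of b for a unit of a cannot increase it.  So a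
-- wide cut sends (τ_{b+1}, b+1) to (τ_{b+1} + 1, b): the parts are distinct, which for
-- a partition forces τ_1 ≥ k.  A tall cut sends (k+1, 1) to (1, k+1), forcing τ_1 ≤ k.
-- If τ_1 = k, the cells (1,k), (k,1) are in τ and (1,k+1), (k+1,1) are not, and
-- monotonicity along antidiagonals leaves only the staircase {a + b ≤ k+1}, which is cut
-- by both L_{k+2,k+1} and L_{k+1,k+2}.  Finally, if τ_1 ≥ k but the given cutting line
-- is not wide, then B ≤ A gives τ_1 ≤ k, so τ is again the staircase.
module Submission where

open import Defs
open import Data.Nat using (ℕ; zero; suc; _+_; _*_; _∸_; _≤_; _<_; _≥_; _>_; z≤n; s≤s; _<?_)
open import Data.Nat.Properties
open import Data.Nat.Tactic.RingSolver using (solve-∀)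
open import Data.Nat.Coprimality as Coprimality using (Coprime; 1-coprimeTo)
open import Data.Integer as ℤ using (+_; +≤+; +<+)
import Data.Integer.Properties as ℤ
open import Data.Rational as ℚ using (mkℚ)
import Data.Rational.Properties as ℚ
open import Data.Rational.Unnormalised as ℚᵘ using (ℚᵘ; mkℚᵘ; *≤*)
import Data.Rational.Unnormalised.Properties as ℚᵘ
open import Data.List using (List; []; _∷_; length)
open import Data.List.Relation.Unary.All using (All; []; _∷_)
open import Data.List.Relation.Unary.Linked using (Linked; []; [-]; _∷_)
open import Data.List.Relation.Unary.Linked.Properties using (Linked⇒AllPairs)
import Data.List.Relation.Unary.AllPairs as AllPairs
open import Data.List.Relation.Unary.Unique.Propositional using (Unique; []; _∷_)
open import Data.Product using (_×_; _,_)
open import Data.Sum using (inj₁; inj₂)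
open import Data.Empty using (⊥-elim)
open import Function using (_∘_)
open import Function.Bundles using (_⇔_; mk⇔; Equivalence)
open import Function.Construct.Symmetry using (⇔-sym)
open import Function.Construct.Composition using (_⇔-∘_)
import Function.Related.Propositional as Related
open import Relation.Nullary using (¬_; yes; no; contradiction)
open import Relation.Binary.PropositionalEquality

open Equivalence using (to; from)

exchange-≤ : ∀ {A B} → A ≤ B → ∀ a c {b d} → a + b ≡ c + d → b ≤ d →
  a * A + b * B ≤ c * A + d * B
exchange-≤ {A} {B} A≤B a c {b} {d} a+b≡c+d b≤d = begin
  a * A + b * B            ≡⟨ cong (λ x → x * A + b * B) a≡c+n ⟩
  (c + n) * A + b * B      ≡⟨ rearrange c n b A B ⟩
  c * A + (n * A + b * B)  ≤⟨ +-monoʳ-≤ (c * A) (+-monoˡ-≤ (b * B) (*-monoʳ-≤ n A≤B)) ⟩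
  c * A + (n * B + b * B)  ≡⟨ cong (_+_ (c * A)) (sym (*-distribʳ-+ B n b)) ⟩
  c * A + (n + b) * B      ≡⟨ cong (λ x → c * A + x * B) n+b≡d ⟩
  c * A + d * B            ∎
  where
  open ≤-Reasoning
  n = d ∸ b
  n+b≡d : n + b ≡ d
  n+b≡d = m∸n+n≡m b≤d
  a≡c+n : a ≡ c + n
  a≡c+n = +-cancelʳ-≡ b a (c + n)
    (trans a+b≡c+d (trans (cong (_+_ c) (sym n+b≡d)) (sym (+-assoc c n b))))
  rearrange : ∀ c n b A B → (c + n) * A + b * B ≡ c * A + (n * A + b * B)
  rearrange = solve-∀

exchange-≥ : ∀ {A B} → B ≤ A → ∀ b d {a c} → a + b ≡ c + d → a ≤ c →
  a * A + b * B ≤ c * A + d * B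
exchange-≥ {A} {B} B≤A b d {a} {c} a+b≡c+d a≤c =
  subst₂ _≤_ (+-comm (b * B) (a * A)) (+-comm (d * B) (c * A))
    (exchange-≤ B≤A b d (trans (+-comm b a) (trans a+b≡c+d (+-comm c d))) a≤c)

-- With A ≤ B the weight on an antidiagonal is largest at its first-column cell and
-- smallest at its first-row cell, so the two corner conditions decide every cell.
staircase-region : ∀ {A B D k} → A ≤ B → 1 * A + k * B ≤ D → ¬ (suc k * A + 1 * B ≤ D) →
  ∀ a b → 1 ≤ a → 1 ≤ b → (a * A + b * B ≤ D) ⇔ (a + b ≤ suc k)
staircase-region {A} {B} {D} {k} A≤B inside outside (suc a) (suc b) _ _ =
  mk⇔ necessary sufficient
  where
  open ≤-Reasoning
  necessary : suc a * A + suc b * B ≤ D → suc a + suc b ≤ suc k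
  necessary w≤D = ≮⇒≥ λ k<a+b → outside (begin
    suc k * A + 1 * B        ≤⟨ +-monoˡ-≤ (1 * B) (*-monoˡ-≤ A (≤-pred k<a+b)) ⟩
    (a + suc b) * A + 1 * B
      ≤⟨ exchange-≤ A≤B (a + suc b) (suc a) (+-comm (a + suc b) 1) (s≤s z≤n) ⟩
    suc a * A + suc b * B    ≤⟨ w≤D ⟩
    D                        ∎)
  sufficient : suc a + suc b ≤ suc k → suc a * A + suc b * B ≤ D
  sufficient a+b≤k = begin
    suc a * A + suc b * B    ≤⟨ exchange-≤ A≤B (suc a) 1 refl (m≤n+m (suc b) a) ⟩
    1 * A + (a + suc b) * B  ≤⟨ +-monoʳ-≤ (1 * A) (*-monoˡ-≤ B (≤-pred a+b≤k)) ⟩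
    1 * A + k * B            ≤⟨ inside ⟩
    D                        ∎

staircase-region′ : ∀ {A B D k} → B ≤ A → k * A + 1 * B ≤ D → ¬ (1 * A + suc k * B ≤ D) →
  ∀ a b → 1 ≤ a → 1 ≤ b → (a * A + b * B ≤ D) ⇔ (a + b ≤ suc k)
staircase-region′ {A} {B} {D} {k} B≤A inside outside a b 1≤a 1≤b = begin
  a * A + b * B ≤ D  ≡⟨ cong (_≤ D) (+-comm (a * A) (b * B)) ⟩
  b * B + a * A ≤ D  ∼⟨ staircase-region B≤A inside′ outside′ b a 1≤b 1≤a ⟩
  b + a ≤ suc k      ≡⟨ cong (_≤ suc k) (+-comm b a) ⟩
  a + b ≤ suc k      ∎
  where
  open Related.EquationalReasoning
  inside′ : 1 * B + k * A ≤ D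
  inside′ = subst (_≤ D) (+-comm (k * A) (1 * B)) inside
  outside′ : ¬ (suc k * B + 1 * A ≤ D)
  outside′ = outside ∘ subst (_≤ D) (+-comm (suc k * B) (1 * A))

InDiagram⇒≤length : ∀ {τ a b} → InDiagram τ a b → b ≤ length τ
InDiagram⇒≤length (_ , b≤k , _ , _) = b≤k

InDiagram⇒≤part : ∀ {τ a b} → InDiagram τ a b → a ≤ part τ b
InDiagram⇒≤part (_ , _ , _ , a≤τb) = a≤τb

InDiagram-first-row : ∀ {x} τ {a} → 1 ≤ a → a ≤ x → InDiagram (x ∷ τ) a 1
InDiagram-first-row _ 1≤a a≤x = s≤s z≤n , s≤s z≤n , 1≤a , a≤x

InDiagram-∷ : ∀ x τ {a b} → InDiagram (x ∷ τ) a (suc (suc b)) ⇔ InDiagram τ a (suc b)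
InDiagram-∷ _ _ = mk⇔ (λ { (_ , s≤s b≤k , 1≤a , a≤τb) → s≤s z≤n , b≤k , 1≤a , a≤τb })
                  (λ (_ , b≤k , 1≤a , a≤τb) → s≤s z≤n , s≤s b≤k , 1≤a , a≤τb)

part-positive : ∀ {τ b} → All (1 ≤_) τ → 1 ≤ b → b ≤ length τ → 1 ≤ part τ b
part-positive {_ ∷ _} {suc zero}    (1≤x ∷ _) _ _        = 1≤x
part-positive {_ ∷ _} {suc (suc b)} (_ ∷ τ⁺)  _ (s≤s b<k) = part-positive τ⁺ (s≤s z≤n) b<k

Linked-by-parts : ∀ {R : ℕ → ℕ → Set} τ →
  (∀ b → 1 ≤ b → suc b ≤ length τ → R (part τ b) (part τ (suc b))) → Linked R τ
Linked-by-parts []           _     = []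
Linked-by-parts (x ∷ [])     _     = [-]
Linked-by-parts (x ∷ y ∷ τ) steps =
  steps 1 (s≤s z≤n) (s≤s (s≤s z≤n)) ∷ Linked-by-parts (y ∷ τ) λ
    { (suc b) _ b<k → steps (suc (suc b)) (s≤s z≤n) (s≤s b<k) }

diagram-injective : ∀ {τ σ} → All (1 ≤_) τ → All (1 ≤_) σ →
  (∀ a b → 1 ≤ a → 1 ≤ b → InDiagram τ a b ⇔ InDiagram σ a b) → τ ≡ σ
diagram-injective [] [] _ = refl
diagram-injective {σ = y ∷ σ} [] (1≤y ∷ _) same =
  contradiction (InDiagram⇒≤length {[]} (from (same y 1 1≤y ≤-refl)
    (InDiagram-first-row σ 1≤y ≤-refl))) λ ()
diagram-injective {τ = x ∷ τ} (1≤x ∷ _) [] same =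
  contradiction (InDiagram⇒≤length {[]} (to (same x 1 1≤x ≤-refl)
    (InDiagram-first-row τ 1≤x ≤-refl))) λ ()
diagram-injective {x ∷ τ} {y ∷ σ} (1≤x ∷ τ⁺) (1≤y ∷ σ⁺) same =
  cong₂ _∷_ (≤-antisym x≤y y≤x) (diagram-injective τ⁺ σ⁺ same-below)
  where
  x≤y : x ≤ y
  x≤y = InDiagram⇒≤part {y ∷ σ} (to (same x 1 1≤x ≤-refl) (InDiagram-first-row τ 1≤x ≤-refl))
  y≤x : y ≤ x
  y≤x = InDiagram⇒≤part {x ∷ τ} (from (same y 1 1≤y ≤-refl) (InDiagram-first-row σ 1≤y ≤-refl))
  same-below : ∀ a b → 1 ≤ a → 1 ≤ b → InDiagram τ a b ⇔ InDiagram σ a b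
  same-below a (suc b) 1≤a _ = begin
    InDiagram τ a (suc b)              ∼⟨ ⇔-sym (InDiagram-∷ x τ) ⟩
    InDiagram (x ∷ τ) a (suc (suc b))  ∼⟨ same a (suc (suc b)) 1≤a (s≤s z≤n) ⟩
    InDiagram (y ∷ σ) a (suc (suc b))  ∼⟨ InDiagram-∷ y σ ⟩
    InDiagram σ a (suc b)              ∎
    where open Related.EquationalReasoning

staircase-positive : ∀ k → All (1 ≤_) (staircase k)
staircase-positive zero    = []
staircase-positive (suc k) = s≤s z≤n ∷ staircase-positive k

staircase-diagram : ∀ k a b → 1 ≤ a → 1 ≤ b → InDiagram (staircase k) a b ⇔ (a + b ≤ suc k)
staircase-diagram zero (suc a) (suc b) _ _ =
  mk⇔ (λ ()) (λ a+b≤1 → contradiction (m+n≤o⇒n≤o a (≤-pred a+b≤1)) λ ())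
staircase-diagram (suc k) a (suc zero) 1≤a _ =
  mk⇔ (λ (_ , _ , _ , a≤k) → subst (_≤ suc (suc k)) (+-comm 1 a) (s≤s a≤k))
      (λ a+1≤k → InDiagram-first-row (staircase k) 1≤a
        (≤-pred (subst (_≤ suc (suc k)) (+-comm a 1) a+1≤k)))
staircase-diagram (suc k) a (suc (suc b)) 1≤a _ = begin
  InDiagram (staircase (suc k)) a (suc (suc b))  ∼⟨ InDiagram-∷ (suc k) (staircase k) ⟩
  InDiagram (staircase k) a (suc b)              ∼⟨ staircase-diagram k a (suc b) 1≤a (s≤s z≤n) ⟩
  a + suc b ≤ suc k                              ∼⟨ mk⇔ s≤s ≤-pred ⟩
  suc (a + suc b) ≤ suc (suc k)                  ≡⟨ cong (_≤ suc (suc k)) (sym (+-suc a (suc b))) ⟩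
  a + suc (suc b) ≤ suc (suc k)                  ∎
  where open Related.EquationalReasoning

Linked>⇒Unique : ∀ {τ} → Linked _>_ τ → Unique τ
Linked>⇒Unique = AllPairs.map >⇒≢ ∘ Linked⇒AllPairs (λ x>y y>z → <-trans y>z x>y)

Unique⇒length≤head : ∀ {x xs} → IsPartition (x ∷ xs) → Unique (x ∷ xs) → length (x ∷ xs) ≤ x
Unique⇒length≤head {xs = []}     (1≤x ∷ _ , _) _ = 1≤x
Unique⇒length≤head {xs = _ ∷ _} (_ ∷ τ⁺ , y≤x ∷ decreasing) ((x≢y ∷ _) ∷ distinct) =
  ≤-trans (s≤s (Unique⇒length≤head (τ⁺ , decreasing) distinct)) (≤∧≢⇒< y≤x (x≢y ∘ sym))

toℚᵘ-ℕ→ℚ-* : ∀ n x → ℚ.toℚᵘ (ℕ→ℚ n ℚ.* x) ℚᵘ.≃ mkℚᵘ (+ n) 0 ℚᵘ.* ℚ.toℚᵘ x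
toℚᵘ-ℕ→ℚ-* n x =
  ℚᵘ.≃-trans (ℚ.toℚᵘ-homo-* (ℕ→ℚ n) x) (ℚᵘ.*-congʳ (ℚ.toℚᵘ-fromℚᵘ (mkℚᵘ (+ n) 0)))

-- For r = (1+p)/(1+q) and s = (1+p′)/(1+q′), multiplying a/r + b/s ≤ 1 by rs gives
-- a(1+q)(1+p′) + b(1+q′)(1+p) ≤ (1+p)(1+p′).
module _ {p q p′ q′ : ℕ} .{c : Coprime (suc p) (suc q)} .{c′ : Coprime (suc p′) (suc q′)} where

  private
    r = mkℚ (+ suc p) q c
    s = mkℚ (+ suc p′) q′ c′

    weighted : ℕ → ℕ → ℚᵘ
    weighted a b = mkℚᵘ (+ a) 0 ℚᵘ.* mkℚᵘ (+ suc q) p ℚᵘ.+ mkℚᵘ (+ b) 0 ℚᵘ.* mkℚᵘ (+ suc q′) p′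

    toℚᵘ-weighted : ∀ a b → ℚ.toℚᵘ (ℕ→ℚ a ℚ.* ℚ.1/ r ℚ.+ ℕ→ℚ b ℚ.* ℚ.1/ s) ℚᵘ.≃ weighted a b
    toℚᵘ-weighted a b = ℚᵘ.≃-trans (ℚ.toℚᵘ-homo-+ (ℕ→ℚ a ℚ.* ℚ.1/ r) (ℕ→ℚ b ℚ.* ℚ.1/ s))
      (ℚᵘ.+-cong (toℚᵘ-ℕ→ℚ-* a (ℚ.1/ r)) (toℚᵘ-ℕ→ℚ-* b (ℚ.1/ s)))

    pos-*-* : ∀ x y z → + x ℤ.* + y ℤ.* + z ≡ + (x * y * z)
    pos-*-* x y z = trans (cong (ℤ._* + z) (sym (ℤ.pos-* x y))) (sym (ℤ.pos-* (x * y) z))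

    numerator : ∀ a b → ℚᵘ.↥ weighted a b ℤ.* + 1 ≡ + (a * (suc q * suc p′) + b * (suc q′ * suc p))
    numerator a b = begin
      ((+ a ℤ.* + suc q) ℤ.* + (1 * suc p′) ℤ.+ (+ b ℤ.* + suc q′) ℤ.* + (1 * suc p)) ℤ.* + 1
        ≡⟨ ℤ.*-identityʳ _ ⟩
      (+ a ℤ.* + suc q) ℤ.* + (1 * suc p′) ℤ.+ (+ b ℤ.* + suc q′) ℤ.* + (1 * suc p)
        ≡⟨ cong₂ ℤ._+_ (pos-*-* a (suc q) (1 * suc p′)) (pos-*-* b (suc q′) (1 * suc p)) ⟩
      + (a * suc q * (1 * suc p′)) ℤ.+ + (b * suc q′ * (1 * suc p))
        ≡⟨ sym (ℤ.pos-+ (a * suc q * (1 * suc p′)) (b * suc q′ * (1 * suc p))) ⟩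
      + (a * suc q * (1 * suc p′) + b * suc q′ * (1 * suc p))
        ≡⟨ cong +_ (reassociate a b (suc q) (suc p′) (suc q′) (suc p)) ⟩
      + (a * (suc q * suc p′) + b * (suc q′ * suc p))
        ∎
      where
      open ≡-Reasoning
      reassociate : ∀ a b x y z w → a * x * (1 * y) + b * z * (1 * w) ≡ a * (x * y) + b * (z * w)
      reassociate = solve-∀

    denominator : ∀ a b → + 1 ℤ.* ℚᵘ.↧ weighted a b ≡ + (suc p * suc p′)
    denominator a b = trans (ℤ.*-identityˡ _) (cong +_ (unit (suc p) (suc p′)))
      where
      unit : ∀ x y → 1 * x * (1 * y) ≡ x * y
      unit = solve-∀

    weighted≤1⇔ : ∀ a b →
      weighted a b ℚᵘ.≤ ℚᵘ.1ℚᵘ ⇔ (a * (suc q * suc p′) + b * (suc q′ * suc p) ≤ suc p * suc p′)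
    weighted≤1⇔ a b = mk⇔
      (λ { (*≤* h) → ℤ.drop‿+≤+ (subst₂ ℤ._≤_ (numerator a b) (denominator a b) h) })
      (λ h → *≤* (subst₂ ℤ._≤_ (sym (numerator a b)) (sym (denominator a b)) (+≤+ h)))

  OnOrBelow-mkℚ⇔ : ∀ {r>0 s>0} a b →
    OnOrBelow (L r s r>0 s>0) a b ⇔ (a * (suc q * suc p′) + b * (suc q′ * suc p) ≤ suc p * suc p′)
  OnOrBelow-mkℚ⇔ a b = begin
    OnOrBelow (L r s _ _) a b
      ∼⟨ mk⇔ ℚ.toℚᵘ-mono-≤ ℚ.toℚᵘ-cancel-≤ ⟩
    ℚ.toℚᵘ (ℕ→ℚ a ℚ.* ℚ.1/ r ℚ.+ ℕ→ℚ b ℚ.* ℚ.1/ s) ℚᵘ.≤ ℚᵘ.1ℚᵘ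
      ∼⟨ mk⇔ (ℚᵘ.≤-respˡ-≃ (toℚᵘ-weighted a b)) (ℚᵘ.≤-respˡ-≃ (ℚᵘ.≃-sym (toℚᵘ-weighted a b))) ⟩
    weighted a b ℚᵘ.≤ ℚᵘ.1ℚᵘ
      ∼⟨ weighted≤1⇔ a b ⟩
    a * (suc q * suc p′) + b * (suc q′ * suc p) ≤ suc p * suc p′
      ∎
    where open Related.EquationalReasoning

  mkℚ-<⇔ : s ℚ.< r ⇔ suc q * suc p′ < suc q′ * suc p
  mkℚ-<⇔ = mk⇔
    (λ { (ℚ.*<* (+<+ h)) → subst₂ _<_ (*-comm (suc p′) (suc q)) (*-comm (suc p) (suc q′)) h })
    (λ h → ℚ.*<* (+<+ (subst₂ _<_ (*-comm (suc q) (suc p′)) (*-comm (suc q′) (suc p)) h)))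

record IntegerForm (ℓ : Line) : Set where
  field
    A B D      : ℕ
    OnOrBelow⇔ : ∀ a b → OnOrBelow ℓ a b ⇔ (a * A + b * B ≤ D)
    s<r⇔A<B    : Line.s ℓ ℚ.< Line.r ℓ ⇔ A < B
    r<s⇔B<A    : Line.r ℓ ℚ.< Line.s ℓ ⇔ B < A

integerForm : (ℓ : Line) → IntegerForm ℓ
integerForm (L (mkℚ (+ suc p) q c) (mkℚ (+ suc p′) q′ c′) _ _) = record
  { A = suc q * suc p′ ; B = suc q′ * suc p ; D = suc p * suc p′
  ; OnOrBelow⇔ = OnOrBelow-mkℚ⇔ {c = c} {c′} ; s<r⇔A<B = mkℚ-<⇔ ; r<s⇔B<A = mkℚ-<⇔ }
integerForm (L (mkℚ (+ zero) _ _) _ r>0 _) = ⊥-elim (ℤ.Positive.pos r>0)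
integerForm (L (mkℚ ℤ.-[1+ _ ] _ _) _ r>0 _) = ⊥-elim (ℤ.Positive.pos r>0)
integerForm (L (mkℚ (+ suc _) _ _) (mkℚ (+ zero) _ _) _ s>0) = ⊥-elim (ℤ.Positive.pos s>0)
integerForm (L (mkℚ (+ suc _) _ _) (mkℚ ℤ.-[1+ _ ] _ _) _ s>0) = ⊥-elim (ℤ.Positive.pos s>0)

IntegerCut : List ℕ → ℕ → ℕ → ℕ → Set
IntegerCut τ A B D = ∀ a b → 1 ≤ a → 1 ≤ b → InDiagram τ a b ⇔ (a * A + b * B ≤ D)

CuttingLine⇒IntegerCut : ∀ {τ ℓ} → CuttingLine τ ℓ →
  let open IntegerForm (integerForm ℓ) in IntegerCut τ A B D
CuttingLine⇒IntegerCut {ℓ = ℓ} cut a b 1≤a 1≤b =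
  IntegerForm.OnOrBelow⇔ (integerForm ℓ) a b ⇔-∘ cut a b 1≤a 1≤b

module _ {x xs A B D} (positive : All (1 ≤_) (x ∷ xs)) (cut : IntegerCut (x ∷ xs) A B D) where

  private
    τ = x ∷ xs
    k = length τ
    1≤k : 1 ≤ k
    1≤k = s≤s z≤n

  head≤length : B ≤ A → x ≤ k
  head≤length B≤A = ≮⇒≥ λ k<x →
    1+n≰n (InDiagram⇒≤length {τ} (from (cut 1 (suc k) (s≤s z≤n) (s≤s z≤n)) (begin
      1 * A + suc k * B  ≤⟨ exchange-≥ B≤A (suc k) 1 (+-comm 1 (suc k)) (s≤s z≤n) ⟩
      suc k * A + 1 * B  ≤⟨ to (cut (suc k) 1 (s≤s z≤n) (s≤s z≤n))
                                (InDiagram-first-row xs (s≤s z≤n) k<x) ⟩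
      D                  ∎)))
    where open ≤-Reasoning

  strictly-decreasing : A ≤ B → Linked _>_ τ
  strictly-decreasing A≤B = Linked-by-parts τ step
    where
    open ≤-Reasoning
    step : ∀ b → 1 ≤ b → suc b ≤ k → part τ b > part τ (suc b)
    step b 1≤b b<k = InDiagram⇒≤part {τ} (from (cut (suc c) b (s≤s z≤n) 1≤b) (begin
      suc c * A + b * B  ≤⟨ exchange-≤ A≤B (suc c) c (sym (+-suc c b)) (n≤1+n b) ⟩
      c * A + suc b * B  ≤⟨ to (cut c (suc b) 1≤c (s≤s z≤n)) (s≤s z≤n , b<k , 1≤c , ≤-refl) ⟩
      D                  ∎))
      where
      c = part τ (suc b)
      1≤c : 1 ≤ c
      1≤c = part-positive positive (s≤s z≤n) b<k

  head≡length⇒staircase : x ≡ k → τ ≡ staircase k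
  head≡length⇒staircase x≡k =
    diagram-injective positive (staircase-positive k) λ a b 1≤a 1≤b → begin
    InDiagram τ a b              ∼⟨ cut a b 1≤a 1≤b ⟩
    a * A + b * B ≤ D            ∼⟨ staircase-shaped a b 1≤a 1≤b ⟩
    a + b ≤ suc k                ∼⟨ ⇔-sym (staircase-diagram k a b 1≤a 1≤b) ⟩
    InDiagram (staircase k) a b  ∎
    where
    open Related.EquationalReasoning
    staircase-shaped : ∀ a b → 1 ≤ a → 1 ≤ b → (a * A + b * B ≤ D) ⇔ (a + b ≤ suc k)
    staircase-shaped with ≤-total A B
    ... | inj₁ A≤B = staircase-region A≤B
      (to (cut 1 k (s≤s z≤n) 1≤k) (1≤k , ≤-refl , s≤s z≤n , part-positive positive 1≤k ≤-refl))
      (λ h → 1+n≰n (subst (suc k ≤_) x≡k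
        (InDiagram⇒≤part {τ} (from (cut (suc k) 1 (s≤s z≤n) (s≤s z≤n)) h))))
    ... | inj₂ B≤A = staircase-region′ B≤A
      (to (cut k 1 1≤k (s≤s z≤n)) (InDiagram-first-row xs 1≤k (≤-reflexive (sym x≡k))))
      (λ h → 1+n≰n (InDiagram⇒≤length {τ} (from (cut 1 (suc k) (s≤s z≤n) (s≤s z≤n)) h)))

wide⇒strictly-decreasing : ∀ {x xs} → All (1 ≤_) (x ∷ xs) → Wide (x ∷ xs) → Linked _>_ (x ∷ xs)
wide⇒strictly-decreasing positive (ℓ , cut , s<r) = strictly-decreasing positive
  (CuttingLine⇒IntegerCut cut) (<⇒≤ (to (IntegerForm.s<r⇔A<B (integerForm ℓ)) s<r))

tall⇒head≤length : ∀ {x xs} → All (1 ≤_) (x ∷ xs) → Tall (x ∷ xs) → x ≤ length (x ∷ xs)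
tall⇒head≤length positive (ℓ , cut , r<s) = head≤length positive
  (CuttingLine⇒IntegerCut cut) (<⇒≤ (to (IntegerForm.r<s⇔B<A (integerForm ℓ)) r<s))

private
  [1+_] : ℕ → ℚ.ℚ
  [1+ n ] = mkℚ (+ suc n) 0 (Coprimality.sym (1-coprimeTo (suc n)))

staircase-wide : ∀ k → Wide (staircase k)
staircase-wide k =
  ℓ , cutting , from (IntegerForm.s<r⇔A<B (integerForm ℓ)) (*-monoʳ-≤ 1 (n<1+n (suc k)))
  where
  ℓ : Line
  ℓ = L [1+ suc k ] [1+ k ] _ _
  inside : 1 * (1 * suc k) + k * (1 * suc (suc k)) ≤ suc (suc k) * suc k
  inside = <⇒≤ (≤-reflexive (sum k))
    where
    sum : ∀ k → suc (1 * (1 * suc k) + k * (1 * suc (suc k))) ≡ suc (suc k) * suc k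
    sum = solve-∀
  outside : ¬ (suc k * (1 * suc k) + 1 * (1 * suc (suc k)) ≤ suc (suc k) * suc k)
  outside = <⇒≱ (≤-reflexive (sum k))
    where
    sum : ∀ k → suc (suc (suc k) * suc k) ≡ suc k * (1 * suc k) + 1 * (1 * suc (suc k))
    sum = solve-∀
  cutting : CuttingLine (staircase k) ℓ
  cutting a b 1≤a 1≤b = begin
    InDiagram (staircase k) a b  ∼⟨ staircase-diagram k a b 1≤a 1≤b ⟩
    a + b ≤ suc k
      ∼⟨ ⇔-sym (staircase-region (*-monoʳ-≤ 1 (n≤1+n (suc k))) inside outside a b 1≤a 1≤b) ⟩
    a * (1 * suc k) + b * (1 * suc (suc k)) ≤ suc (suc k) * suc k
      ∼⟨ ⇔-sym (IntegerForm.OnOrBelow⇔ (integerForm ℓ) a b) ⟩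
    OnOrBelow ℓ a b              ∎
    where open Related.EquationalReasoning

staircase-tall : ∀ k → Tall (staircase k)
staircase-tall k =
  ℓ , cutting , from (IntegerForm.r<s⇔B<A (integerForm ℓ)) (*-monoʳ-≤ 1 (n<1+n (suc k)))
  where
  ℓ : Line
  ℓ = L [1+ k ] [1+ suc k ] _ _
  inside : k * (1 * suc (suc k)) + 1 * (1 * suc k) ≤ suc k * suc (suc k)
  inside = <⇒≤ (≤-reflexive (sum k))
    where
    sum : ∀ k → suc (k * (1 * suc (suc k)) + 1 * (1 * suc k)) ≡ suc k * suc (suc k)
    sum = solve-∀
  outside : ¬ (1 * (1 * suc (suc k)) + suc k * (1 * suc k) ≤ suc k * suc (suc k))
  outside = <⇒≱ (≤-reflexive (sum k))
    where
    sum : ∀ k → suc (suc k * suc (suc k)) ≡ 1 * (1 * suc (suc k)) + suc k * (1 * suc k)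
    sum = solve-∀
  cutting : CuttingLine (staircase k) ℓ
  cutting a b 1≤a 1≤b = begin
    InDiagram (staircase k) a b  ∼⟨ staircase-diagram k a b 1≤a 1≤b ⟩
    a + b ≤ suc k
      ∼⟨ ⇔-sym (staircase-region′ (*-monoʳ-≤ 1 (n≤1+n (suc k))) inside outside a b 1≤a 1≤b) ⟩
    a * (1 * suc (suc k)) + b * (1 * suc k) ≤ suc k * suc (suc k)
      ∼⟨ ⇔-sym (IntegerForm.OnOrBelow⇔ (integerForm ℓ) a b) ⟩
    OnOrBelow ℓ a b              ∎
    where open Related.EquationalReasoning

lemma5p5 : (τ : List ℕ) → IsPartition τ → τ ≢ [] → Triangular τ →
    ((Wide τ ⇔ (part τ 1 ≥ length τ)) × ((part τ 1 ≥ length τ) ⇔ Unique τ))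
    × (((Wide τ × Tall τ) ⇔ (part τ 1 ≡ length τ))
       × ((part τ 1 ≡ length τ) ⇔ (τ ≡ staircase (length τ))))
lemma5p5 [] _ τ≢[] _ = ⊥-elim (τ≢[] refl)
lemma5p5 τ@(x ∷ xs) partition@(positive , _) _ (ℓ , cut) =
  ( mk⇔ (distinct⇒length≤head ∘ wide⇒distinct) length≤head⇒wide
  , mk⇔ (wide⇒distinct ∘ length≤head⇒wide) distinct⇒length≤head )
  , ( mk⇔ (λ (wide , tall) → ≤-antisym (tall⇒head≤length positive tall)
                                         (distinct⇒length≤head (wide⇒distinct wide)))
          (λ x≡k → subst (λ σ → Wide σ × Tall σ) (sym (is-staircase x≡k))
                         (staircase-wide k , staircase-tall k))
    , mk⇔ is-staircase (cong (λ σ → part σ 1)) )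
  where
  k = length τ
  open IntegerForm (integerForm ℓ)
  integer-cut : IntegerCut τ A B D
  integer-cut = CuttingLine⇒IntegerCut {ℓ = ℓ} cut
  wide⇒distinct : Wide τ → Unique τ
  wide⇒distinct = Linked>⇒Unique ∘ wide⇒strictly-decreasing positive
  distinct⇒length≤head : Unique τ → k ≤ x
  distinct⇒length≤head = Unique⇒length≤head partition
  is-staircase : x ≡ k → τ ≡ staircase k
  is-staircase = head≡length⇒staircase positive integer-cut
  length≤head⇒wide : k ≤ x → Wide τ
  length≤head⇒wide k≤x with A <? B
  ... | yes A<B = ℓ , cut , from s<r⇔A<B A<B
  ... | no A≮B  = subst Wide (sym (is-staircase x≡k)) (staircase-wide k)
    where
    x≡k : x ≡ k
    x≡k = ≤-antisym (head≤length positive integer-cut (≮⇒≥ A≮B)) k≤x
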